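{- Let $F(x,y)\in\mathbb Z[x,y]$ be an irreducible binary form of degree $r\ge3$ and $h\ge1$ an integer. Then (i) $N(F,h)\le P(F,h)\,h^{1/r}$; (ii) $N(F,h)\le P(F,h)+h^{1/r}\sum_{m=1}^{h-1}P(F,m)\,r^{ -1}m^{ -1-1/r}$.
   Context: For an integer $m\ge1$, $N(F,m)$ is the number of pairs $(x,y)\in\mathbb Z^2$, $(x,y)\ne(0,0)$, with $|F(x,y)|\le m$, and $P(F,m)$ is the number of such pairs with $\gcd(x,y)=1$ (primitive solutions). -}

module Defs where

open import Data.Nat as ℕ using (ℕ; zero; suc; _<?_; _∸_)
open import Data.Nat.GCD using (gcd)
open import Data.Fin using (Fin; fromℕ<)
open import Data.Integer as ℤ using (ℤ; +_; -[1+_]; ∣_∣)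
open import Data.Rational as ℚ using (ℚ; 0ℚ; 1ℚ)
open import Data.Product using (Σ; _×_; ∃)
open import Data.Sum using (_⊎_)
open import Data.List using (List; length)
open import Data.List.Membership.Propositional using (_∈_)
open import Data.List.Relation.Unary.Unique.Propositional using (Unique)
open import Function.Bundles using (_⇔_)
open import Relation.Nullary using (¬_; yes; no)
open import Relation.Binary.PropositionalEquality using (_≡_)

-- A binary form of degree d: F(x,y) = Σ_{i=0}^{d} a_i x^{d-i} y^i,
-- represented by its coefficient vector (a_0, …, a_d).
Form : ℕ → Set
Form d = Fin (suc d) → ℤ

coef : ∀ {d} → Form d → ℕ → ℤ
coef {d} F k with k <? suc d
... | yes k<d = F (fromℕ< k<d)
... | no  _   = + 0

sumℤ : ℕ → (ℕ → ℤ) → ℤ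
sumℤ zero    g = + 0
sumℤ (suc n) g = sumℤ n g ℤ.+ g n

_·_ : ∀ {s t} → Form s → Form t → Form (s ℕ.+ t)
(G · H) j = sumℤ (suc (Data.Fin.toℕ j)) (λ i → coef G i ℤ.* coef H (Data.Fin.toℕ j ∸ i))

IsUnitForm : ∀ {s} → Form s → Set
IsUnitForm {s} G = (s ≡ 0) × ((coef G 0 ≡ + 1) ⊎ (coef G 0 ≡ -[1+ 0 ]))

-- irreducible as an element of ℤ[x,y]: nonzero, and every factorisation
-- F = G·H into (necessarily homogeneous) factors has a unit factor.
-- (Since r ≥ 3 is assumed separately, F is not a unit.)
Irreducible : ∀ {r} → Form r → Set
Irreducible {r} F =
  (¬ (∀ k → coef F k ≡ + 0)) ×
  (∀ s t → s ℕ.+ t ≡ r → (G : Form s) (H : Form t) →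
     (∀ k → coef (G · H) k ≡ coef F k) → IsUnitForm G ⊎ IsUnitForm H)

eval : ∀ {d} → Form d → ℤ → ℤ → ℤ
eval {d} F x y = sumℤ (suc d) (λ i → coef F i ℤ.* (x ℤ.^ (d ∸ i)) ℤ.* (y ℤ.^ i))

Sol : ∀ {d} → Form d → ℕ → ℤ × ℤ → Set
Sol F m (x Data.Product., y) = (¬ ((x ≡ + 0) × (y ≡ + 0))) × (∣ eval F x y ∣ ℕ.≤ m)

PrimSol : ∀ {d} → Form d → ℕ → ℤ × ℤ → Set
PrimSol F m (x Data.Product., y) = Sol F m (x Data.Product., y) × (gcd ∣ x ∣ ∣ y ∣ ≡ 1)

IsCount : (ℤ × ℤ → Set) → ℕ → Set
IsCount P n = ∃ λ (xs : List (ℤ × ℤ)) →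
  Unique xs × (∀ p → P p ⇔ (p ∈ xs)) × (length xs ≡ n)

_^ℚ_ : ℚ → ℕ → ℚ
q ^ℚ zero  = 1ℚ
q ^ℚ suc n = q ℚ.* (q ^ℚ n)

-- 1/n as a rational (value 0 at n = 0, never used there)
invℕ : ℕ → ℚ
invℕ zero    = 0ℚ
invℕ (suc n) = + 1 ℚ./ suc n

-- Σ_{m=1}^{h-1} g m
sumFrom1 : ℕ → (ℕ → ℚ) → ℚ
sumFrom1 zero          g = 0ℚ
sumFrom1 (suc zero)    g = 0ℚ
sumFrom1 (suc (suc n)) g = sumFrom1 (suc n) g ℚ.+ g (suc n)

-- A solution (x, y) of |F(x, y)| ≤ h is g·(x′, y′) with (x′, y′) primitive and g ≥ 1, and
-- g^r |F(x′, y′)| ≤ h. As F(x′, y′) ≠ 0, this forces g^r ≤ h and |F(x′, y′)| ≤ ⌊h/g^r⌋, so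
-- N ≤ Σ_{g=1}^{D} P(⌊h/g^r⌋) with D = ⌊h^{1/r}⌋. Each term is at most P(h), which gives (i).
-- For (ii), summation by parts over the layers ⌊h/(g+1)^r⌋ ≤ m < ⌊h/g^r⌋ bounds
-- Σ_{g≥2} P(⌊h/g^r⌋) by Σ_m P(m) q_m/(rm), because the weights q_m/(rm) over ⌊h/g^r⌋ ≤ m < h
-- add up to at least g - 1. This is a discrete form of ∫_{h/g^r}^{h} (h/t)^{1/r} dt/(rt) = g - 1,
-- proved one step at a time from Bernoulli's inequality.

module Submission where

open import Defs
open import Data.Nat as ℕ using (ℕ; _≤_; _<_; _^_; _*_)
open import Data.Integer using (+_)
open import Data.Rational as ℚ using (ℚ; 0ℚ)
open import Data.Product using (_×_)

open import Data.Empty using (⊥-elim)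
open import Data.Integer as ℤ using (ℤ)
import Data.Integer.Divisibility.Signed as Signed
import Data.Integer.Properties as ℤP
import Data.Integer.Tactic.RingSolver as ℤ-Solver
open import Data.List using (List; []; _∷_; _++_; length; map; upTo)
open import Data.List.Membership.Propositional using (_∈_)
open import Data.List.Membership.Propositional.Properties using (∈-∃++; ∈-++⁻; ∈-++⁺ˡ; ∈-++⁺ʳ; ∈-map⁺; ∈-map⁻)
import Data.List.Properties as LP
open import Data.List.Relation.Binary.Subset.Propositional using (_⊆_)
import Data.List.Relation.Unary.All as All
open import Data.List.Relation.Unary.AllPairs using (_∷_)
open import Data.List.Relation.Unary.Any using (here; there)
open import Data.List.Relation.Unary.Unique.Propositional using (Unique)
import Data.List.Relation.Unary.Unique.Propositional.Properties as UniqueP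
open import Data.Nat using (zero; suc; z≤n; s≤s; _≤′_; ≤′-refl; ≤′-step; _≤?_)
import Data.Nat.DivMod as ℕD
open import Data.Nat.Divisibility using (_∣_)
open import Data.Nat.GCD using (gcd; gcd[m,n]∣m; gcd[m,n]∣n; gcd[m,n]≡0⇒m≡0; gcd[m,n]≡0⇒n≡0; c*gcd[m,n]≡gcd[cm,cn]; gcd[0,0]≡0)
import Data.Nat.Properties as ℕP
import Data.Nat.Tactic.RingSolver as ℕ-Solver
open import Data.Product using (_,_; proj₁; proj₂; ∃; ∃₂)
open import Data.Rational using (1ℚ; toℚᵘ)
import Data.Rational.Properties as ℚP
open import Data.Rational.Unnormalised as ℚᵘ using (mkℚᵘ; *≡*) renaming (_≃_ to _≃ᵘ_)
import Data.Rational.Unnormalised.Properties as ℚᵘP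
open import Data.Sum using (inj₁; inj₂)
open import Function using (_∘_)
open import Function.Bundles using (Equivalence; _⇔_)
open import Level using (0ℓ)
open import Relation.Binary.PropositionalEquality
open import Relation.Nullary using (¬_; yes; no; contradiction)
open import Relation.Nullary.Decidable.Core using (dec⇒maybe)
import Tactic.RingSolver as RingSolver
open import Tactic.RingSolver.Core.AlmostCommutativeRing using (AlmostCommutativeRing; fromCommutativeRing)

-- Rational arithmetic

ℚ-ring : AlmostCommutativeRing 0ℓ 0ℓ
ℚ-ring = fromCommutativeRing ℚP.+-*-commutativeRing (λ x → dec⇒maybe (0ℚ ℚP.≟ x))

fromℕ : ℕ → ℚ
fromℕ n = + n ℚ./ 1

toℚᵘ-fromℕ : ∀ n → toℚᵘ (fromℕ n) ≃ᵘ mkℚᵘ (+ n) 0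
toℚᵘ-fromℕ n = ℚP.toℚᵘ-fromℚᵘ (mkℚᵘ (+ n) 0)

fromℕ-+ : ∀ m n → fromℕ (m ℕ.+ n) ≡ fromℕ m ℚ.+ fromℕ n
fromℕ-+ m n = ℚP.toℚᵘ-injective (begin
  toℚᵘ (fromℕ (m ℕ.+ n))              ≈⟨ toℚᵘ-fromℕ (m ℕ.+ n) ⟩
  mkℚᵘ (+ (m ℕ.+ n)) 0                ≈⟨ *≡* cross ⟩
  mkℚᵘ (+ m) 0 ℚᵘ.+ mkℚᵘ (+ n) 0      ≈⟨ ℚᵘP.+-cong (toℚᵘ-fromℕ m) (toℚᵘ-fromℕ n) ⟨
  toℚᵘ (fromℕ m) ℚᵘ.+ toℚᵘ (fromℕ n)  ≈⟨ ℚP.toℚᵘ-homo-+ (fromℕ m) (fromℕ n) ⟨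
  toℚᵘ (fromℕ m ℚ.+ fromℕ n)          ∎)
  where
  open ℚᵘP.≃-Reasoning
  cross : + (m ℕ.+ n) ℤ.* + 1 ≡ (+ m ℤ.* + 1 ℤ.+ + n ℤ.* + 1) ℤ.* + 1
  cross = cong (ℤ._* + 1) (trans (ℤP.pos-+ m n)
            (sym (cong₂ ℤ._+_ (ℤP.*-identityʳ (+ m)) (ℤP.*-identityʳ (+ n)))))

fromℕ-* : ∀ m n → fromℕ (m * n) ≡ fromℕ m ℚ.* fromℕ n
fromℕ-* m n = ℚP.toℚᵘ-injective (begin
  toℚᵘ (fromℕ (m * n))                ≈⟨ toℚᵘ-fromℕ (m * n) ⟩
  mkℚᵘ (+ (m * n)) 0                  ≈⟨ *≡* (cong (ℤ._* + 1) (ℤP.pos-* m n)) ⟩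
  mkℚᵘ (+ m) 0 ℚᵘ.* mkℚᵘ (+ n) 0      ≈⟨ ℚᵘP.*-cong (toℚᵘ-fromℕ m) (toℚᵘ-fromℕ n) ⟨
  toℚᵘ (fromℕ m) ℚᵘ.* toℚᵘ (fromℕ n)  ≈⟨ ℚP.toℚᵘ-homo-* (fromℕ m) (fromℕ n) ⟨
  toℚᵘ (fromℕ m ℚ.* fromℕ n)          ∎)
  where open ℚᵘP.≃-Reasoning

fromℕ-^ : ∀ m n → fromℕ (m ^ n) ≡ fromℕ m ^ℚ n
fromℕ-^ m zero    = refl
fromℕ-^ m (suc n) = trans (fromℕ-* m (m ^ n)) (cong (fromℕ m ℚ.*_) (fromℕ-^ m n))

fromℕ-nonNeg : ∀ n → 0ℚ ℚ.≤ fromℕ n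
fromℕ-nonNeg n = ℚP.nonNegative⁻¹ _ {{ℚP.normalize-nonNeg n 1}}

fromℕ-pos : ∀ n → 0ℚ ℚ.< fromℕ (suc n)
fromℕ-pos n = ℚP.positive⁻¹ _ {{ℚP.normalize-pos (suc n) 1}}

fromℕ-mono-≤ : ∀ {m n} → m ≤ n → fromℕ m ℚ.≤ fromℕ n
fromℕ-mono-≤ {m} m≤n with ℕP.m≤n⇒∃[o]m+o≡n m≤n
... | o , refl = begin
  fromℕ m               ≡⟨ ℚP.+-identityʳ (fromℕ m) ⟨
  fromℕ m ℚ.+ 0ℚ        ≤⟨ ℚP.+-monoʳ-≤ (fromℕ m) (fromℕ-nonNeg o) ⟩
  fromℕ m ℚ.+ fromℕ o   ≡⟨ fromℕ-+ m o ⟨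
  fromℕ (m ℕ.+ o)       ∎
  where open ℚP.≤-Reasoning

fromℕ*invℕ : ∀ n → fromℕ (suc n) ℚ.* invℕ (suc n) ≡ 1ℚ
fromℕ*invℕ n = ℚP.toℚᵘ-injective (begin
  toℚᵘ (fromℕ (suc n) ℚ.* invℕ (suc n))        ≈⟨ ℚP.toℚᵘ-homo-* (fromℕ (suc n)) (invℕ (suc n)) ⟩
  toℚᵘ (fromℕ (suc n)) ℚᵘ.* toℚᵘ (invℕ (suc n)) ≈⟨ ℚᵘP.*-cong (toℚᵘ-fromℕ (suc n)) (ℚP.toℚᵘ-fromℚᵘ (mkℚᵘ (+ 1) n)) ⟩
  mkℚᵘ (+ suc n) 0 ℚᵘ.* mkℚᵘ (+ 1) n           ≈⟨ *≡* cross ⟩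
  ℚᵘ.1ℚᵘ                                       ∎)
  where
  open ℚᵘP.≃-Reasoning
  cross : (+ suc n ℤ.* + 1) ℤ.* + 1 ≡ + 1 ℤ.* + (1 * suc n)
  cross = trans (ℤP.*-identityʳ _) (trans (ℤP.*-identityʳ _)
            (trans (cong +_ (sym (ℕP.*-identityˡ (suc n)))) (sym (ℤP.*-identityˡ _))))

invℕ-nonNeg : ∀ n → 0ℚ ℚ.≤ invℕ n
invℕ-nonNeg zero    = ℚP.≤-refl
invℕ-nonNeg (suc n) = ℚP.nonNegative⁻¹ _ {{ℚP.normalize-nonNeg 1 (suc n)}}

invℕ≤1 : ∀ n → invℕ n ℚ.≤ 1ℚ
invℕ≤1 zero    = ℚP.nonNegative⁻¹ 1ℚ
invℕ≤1 (suc n) = begin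
  invℕ (suc n)                    ≡⟨ ℚP.*-identityʳ (invℕ (suc n)) ⟨
  invℕ (suc n) ℚ.* fromℕ 1        ≤⟨ ℚP.*-monoˡ-≤-nonNeg (invℕ (suc n)) {{ℚ.nonNegative (invℕ-nonNeg (suc n))}}
                                       (fromℕ-mono-≤ {1} {suc n} (s≤s z≤n)) ⟩
  invℕ (suc n) ℚ.* fromℕ (suc n)  ≡⟨ trans (ℚP.*-comm (invℕ (suc n)) (fromℕ (suc n))) (fromℕ*invℕ n) ⟩
  1ℚ                              ∎
  where open ℚP.≤-Reasoning

p≤q⇒0≤q-p : ∀ {p q} → p ℚ.≤ q → 0ℚ ℚ.≤ q ℚ.- p
p≤q⇒0≤q-p {p} {q} p≤q = subst (ℚ._≤ q ℚ.- p) (ℚP.+-inverseʳ p) (ℚP.+-monoˡ-≤ (ℚ.- p) p≤q)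

*-nonNeg : ∀ {p q} → 0ℚ ℚ.≤ p → 0ℚ ℚ.≤ q → 0ℚ ℚ.≤ p ℚ.* q
*-nonNeg {p} {q} 0≤p 0≤q =
  ℚP.nonNegative⁻¹ _ {{ℚP.nonNeg*nonNeg⇒nonNeg p {{ℚ.nonNegative 0≤p}} q {{ℚ.nonNegative 0≤q}}}}

^ℚ-zeroˡ : ∀ n → 1ℚ ^ℚ n ≡ 1ℚ
^ℚ-zeroˡ zero    = refl
^ℚ-zeroˡ (suc n) = trans (ℚP.*-identityˡ _) (^ℚ-zeroˡ n)

^ℚ-distribʳ-* : ∀ p q n → (p ℚ.* q) ^ℚ n ≡ p ^ℚ n ℚ.* q ^ℚ n
^ℚ-distribʳ-* p q zero    = refl
^ℚ-distribʳ-* p q (suc n) =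
  trans (cong ((p ℚ.* q) ℚ.*_) (^ℚ-distribʳ-* p q n)) (interchange p q (p ^ℚ n) (q ^ℚ n))
  where
  interchange : ∀ a b c d → (a ℚ.* b) ℚ.* (c ℚ.* d) ≡ (a ℚ.* c) ℚ.* (b ℚ.* d)
  interchange = RingSolver.solve-∀ ℚ-ring

^ℚ-nonNeg : ∀ {p} n → 0ℚ ℚ.≤ p → 0ℚ ℚ.≤ p ^ℚ n
^ℚ-nonNeg zero    _   = ℚP.nonNegative⁻¹ 1ℚ
^ℚ-nonNeg (suc n) 0≤p = *-nonNeg 0≤p (^ℚ-nonNeg n 0≤p)

^ℚ-pos : ∀ {p} n → 0ℚ ℚ.< p → 0ℚ ℚ.< p ^ℚ n
^ℚ-pos zero    _   = ℚP.positive⁻¹ 1ℚ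
^ℚ-pos {p} (suc n) 0<p =
  ℚP.positive⁻¹ _ {{ℚP.pos*pos⇒pos p {{ℚ.positive 0<p}} (p ^ℚ n) {{ℚ.positive (^ℚ-pos n 0<p)}}}}

^ℚ-monoˡ-≤ : ∀ {p q} n → 0ℚ ℚ.≤ p → p ℚ.≤ q → p ^ℚ n ℚ.≤ q ^ℚ n
^ℚ-monoˡ-≤ zero    _   _   = ℚP.≤-refl
^ℚ-monoˡ-≤ {p} {q} (suc n) 0≤p p≤q = ℚP.≤-trans
  (ℚP.*-monoˡ-≤-nonNeg p {{ℚ.nonNegative 0≤p}} (^ℚ-monoˡ-≤ n 0≤p p≤q))
  (ℚP.*-monoʳ-≤-nonNeg (q ^ℚ n) {{ℚ.nonNegative (^ℚ-nonNeg n (ℚP.≤-trans 0≤p p≤q))}} p≤q)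

^ℚ-monoˡ-< : ∀ {p q} n → 0ℚ ℚ.≤ p → p ℚ.< q → p ^ℚ suc n ℚ.< q ^ℚ suc n
^ℚ-monoˡ-< {p} {q} n 0≤p p<q = ℚP.≤-<-trans
  (ℚP.*-monoˡ-≤-nonNeg p {{ℚ.nonNegative 0≤p}} (^ℚ-monoˡ-≤ n 0≤p (ℚP.<⇒≤ p<q)))
  (ℚP.*-monoˡ-<-pos (q ^ℚ n) {{ℚ.positive (^ℚ-pos n (ℚP.≤-<-trans 0≤p p<q))}} p<q)

^ℚ-cancelˡ-≤ : ∀ {p q} n → 0ℚ ℚ.≤ q → p ^ℚ suc n ℚ.≤ q ^ℚ suc n → p ℚ.≤ q
^ℚ-cancelˡ-≤ n 0≤q pⁿ≤qⁿ = ℚP.≮⇒≥ λ q<p →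
  ℚP.<-irrefl refl (ℚP.<-≤-trans (^ℚ-monoˡ-< n 0≤q q<p) pⁿ≤qⁿ)

-- Finite sums and summation by parts

sumℚ : ℕ → (ℕ → ℚ) → ℚ
sumℚ zero    g = 0ℚ
sumℚ (suc n) g = sumℚ n g ℚ.+ g n

-- Σ_{m ≤ i < n} g i, meaningful for m ≤ n
sumRange : ℕ → ℕ → (ℕ → ℚ) → ℚ
sumRange m n g = sumℚ n g ℚ.- sumℚ m g

sumℚ-nonNeg : ∀ n g → (∀ i → i < n → 0ℚ ℚ.≤ g i) → 0ℚ ℚ.≤ sumℚ n g
sumℚ-nonNeg zero    g _    = ℚP.≤-refl
sumℚ-nonNeg (suc n) g g≥0 =
  ℚP.+-mono-≤ (sumℚ-nonNeg n g (λ i i<n → g≥0 i (ℕP.m≤n⇒m≤1+n i<n))) (g≥0 n ℕP.≤-refl)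

sumℚ-mono-≤ : ∀ n {f g} → (∀ i → i < n → f i ℚ.≤ g i) → sumℚ n f ℚ.≤ sumℚ n g
sumℚ-mono-≤ zero    _   = ℚP.≤-refl
sumℚ-mono-≤ (suc n) f≤g = ℚP.+-mono-≤ (sumℚ-mono-≤ n λ i i<n → f≤g i (ℕP.m≤n⇒m≤1+n i<n)) (f≤g n ℕP.≤-refl)

sumℚ-suc : ∀ n g → sumℚ (suc n) g ≡ g 0 ℚ.+ sumℚ n (g ∘ suc)
sumℚ-suc zero    g = ℚP.+-comm 0ℚ (g 0)
sumℚ-suc (suc n) g = trans (cong (ℚ._+ g (suc n)) (sumℚ-suc n g)) (ℚP.+-assoc (g 0) _ _)

sumℚ-telescope : ∀ n (U : ℕ → ℚ) → sumℚ n (λ j → U (suc j) ℚ.- U j) ≡ U n ℚ.- U 0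
sumℚ-telescope zero    U = sym (ℚP.+-inverseʳ (U 0))
sumℚ-telescope (suc n) U =
  trans (cong (ℚ._+ (U (suc n) ℚ.- U n)) (sumℚ-telescope n U)) (cancel (U n) (U 0) (U (suc n)))
  where
  cancel : ∀ a b c → (a ℚ.- b) ℚ.+ (c ℚ.- a) ≡ c ℚ.- b
  cancel = RingSolver.solve-∀ ℚ-ring

sumℚ≡sumFrom1 : ∀ n g → g 0 ≡ 0ℚ → sumℚ n g ≡ sumFrom1 n g
sumℚ≡sumFrom1 zero          g _   = refl
sumℚ≡sumFrom1 (suc zero)    g g₀≡0 = trans (ℚP.+-identityˡ (g 0)) g₀≡0
sumℚ≡sumFrom1 (suc (suc n)) g g₀≡0 = cong (ℚ._+ g (suc n)) (sumℚ≡sumFrom1 (suc n) g g₀≡0)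

*-sumRange-≤ : ∀ {m n} c (w g : ℕ → ℚ) → m ≤ n → (∀ i → m ≤ i → i < n → c ℚ.* w i ℚ.≤ g i) →
               c ℚ.* sumRange m n w ℚ.≤ sumRange m n g
*-sumRange-≤ {m} c w g m≤n = go (ℕP.≤⇒≤′ m≤n)
  where
  open ℚP.≤-Reasoning
  distrib : ∀ c a b d → c ℚ.* ((a ℚ.+ b) ℚ.- d) ≡ c ℚ.* (a ℚ.- d) ℚ.+ c ℚ.* b
  distrib = RingSolver.solve-∀ ℚ-ring
  regroup : ∀ a b d → (a ℚ.- d) ℚ.+ b ≡ (a ℚ.+ b) ℚ.- d
  regroup = RingSolver.solve-∀ ℚ-ring
  go : ∀ {n} → m ≤′ n → (∀ i → m ≤ i → i < n → c ℚ.* w i ℚ.≤ g i) →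
       c ℚ.* sumRange m n w ℚ.≤ sumRange m n g
  go ≤′-refl _ = ℚP.≤-reflexive (begin-equality
    c ℚ.* sumRange m m w  ≡⟨ cong (c ℚ.*_) (ℚP.+-inverseʳ (sumℚ m w)) ⟩
    c ℚ.* 0ℚ              ≡⟨ ℚP.*-zeroʳ c ⟩
    0ℚ                    ≡⟨ ℚP.+-inverseʳ (sumℚ m g) ⟨
    sumRange m m g        ∎)
  go {suc n} (≤′-step m≤′n) cw≤g = begin
    c ℚ.* sumRange m (suc n) w                       ≡⟨ distrib c (sumℚ n w) (w n) (sumℚ m w) ⟩
    c ℚ.* sumRange m n w ℚ.+ c ℚ.* w n               ≤⟨ ℚP.+-mono-≤ (go m≤′n λ i m≤i i<n → cw≤g i m≤i (ℕP.m≤n⇒m≤1+n i<n))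
                                                                    (cw≤g n (ℕP.≤′⇒≤ m≤′n) ℕP.≤-refl) ⟩
    sumRange m n g ℚ.+ g n                           ≡⟨ regroup (sumℚ n g) (g n) (sumℚ m g) ⟩
    sumRange m (suc n) g                             ∎

abel-summation-≤ : ∀ n (c V : ℕ → ℚ) → V 0 ≡ 0ℚ → (∀ j → j ≤ n → fromℕ j ℚ.≤ V j) →
                   (∀ j → j < n → 0ℚ ℚ.≤ c j) → (∀ j → suc j < n → c (suc j) ℚ.≤ c j) →
                   sumℚ n c ℚ.≤ sumℚ n (λ j → c j ℚ.* (V (suc j) ℚ.- V j))
abel-summation-≤ zero    c V _    _  _   _      = ℚP.≤-refl
abel-summation-≤ (suc n) c V V₀≡0 j≤V 0≤c c-anti = begin
  sumℚ (suc n) c                                          ≡⟨ ℚP.+-identityʳ _ ⟨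
  sumℚ (suc n) c ℚ.+ 0ℚ                                   ≤⟨ ℚP.+-monoʳ-≤ (sumℚ (suc n) c) (*-nonNeg (0≤c n ℕP.≤-refl) (excess n ℕP.≤-refl)) ⟩
  sumℚ (suc n) c ℚ.+ c n ℚ.* (V (suc n) ℚ.- fromℕ (suc n)) ≤⟨ invariant n ℕP.≤-refl ⟩
  sumℚ (suc n) cΔV                                        ∎
  where
  open ℚP.≤-Reasoning
  cΔV : ℕ → ℚ
  cΔV j = c j ℚ.* (V (suc j) ℚ.- V j)
  excess : ∀ j → suc j ≤ suc n → 0ℚ ℚ.≤ V (suc j) ℚ.- fromℕ (suc j)
  excess j j<n = p≤q⇒0≤q-p (j≤V (suc j) j<n)
  base : ∀ c v → (0ℚ ℚ.+ c) ℚ.+ c ℚ.* (v ℚ.- 1ℚ) ≡ 0ℚ ℚ.+ c ℚ.* (v ℚ.- 0ℚ)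
  base = RingSolver.solve-∀ ℚ-ring
  shift : ∀ s c x y t → (s ℚ.+ c) ℚ.+ c ℚ.* (y ℚ.- (1ℚ ℚ.+ t)) ≡ (s ℚ.+ c ℚ.* (x ℚ.- t)) ℚ.+ c ℚ.* (y ℚ.- x)
  shift = RingSolver.solve-∀ ℚ-ring
  -- preserved because c is nonincreasing and j + 1 ≤ V (j + 1)
  invariant : ∀ j → j < suc n →
              sumℚ (suc j) c ℚ.+ c j ℚ.* (V (suc j) ℚ.- fromℕ (suc j)) ℚ.≤ sumℚ (suc j) cΔV
  invariant zero _ = ℚP.≤-reflexive (trans (base (c 0) (V 1)) (cong (λ t → 0ℚ ℚ.+ c 0 ℚ.* (V 1 ℚ.- t)) (sym V₀≡0)))
  invariant (suc j) (s≤s j<n) = begin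
    sumℚ (suc (suc j)) c ℚ.+ c′ ℚ.* (V (suc (suc j)) ℚ.- fromℕ (suc (suc j)))
      ≡⟨ cong (λ t → sumℚ (suc (suc j)) c ℚ.+ c′ ℚ.* (V (suc (suc j)) ℚ.- t)) (fromℕ-+ 1 (suc j)) ⟩
    sumℚ (suc (suc j)) c ℚ.+ c′ ℚ.* (V (suc (suc j)) ℚ.- (1ℚ ℚ.+ fromℕ (suc j)))
      ≡⟨ shift (sumℚ (suc j) c) c′ (V (suc j)) (V (suc (suc j))) (fromℕ (suc j)) ⟩
    (sumℚ (suc j) c ℚ.+ c′ ℚ.* (V (suc j) ℚ.- fromℕ (suc j))) ℚ.+ cΔV (suc j)
      ≤⟨ ℚP.+-monoˡ-≤ (cΔV (suc j)) (ℚP.+-monoʳ-≤ (sumℚ (suc j) c)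
           (ℚP.*-monoʳ-≤-nonNeg _ {{ℚ.nonNegative (excess j (ℕP.m≤n⇒m≤1+n j<n))}} (c-anti j (s≤s j<n)))) ⟩
    (sumℚ (suc j) c ℚ.+ c j ℚ.* (V (suc j) ℚ.- fromℕ (suc j))) ℚ.+ cΔV (suc j)
      ≤⟨ ℚP.+-monoˡ-≤ (cΔV (suc j)) (invariant j (ℕP.m≤n⇒m≤1+n j<n)) ⟩
    sumℚ (suc (suc j)) cΔV
      ∎
    where
    c′ : ℚ
    c′ = c (suc j)

-- Integer parts of h / (1 + j) ^ r and of the r-th root of h

^-distribʳ-* : ∀ m n k → (m * n) ^ k ≡ m ^ k * n ^ k
^-distribʳ-* m n zero    = refl
^-distribʳ-* m n (suc k) = trans (cong (m * n *_) (^-distribʳ-* m n k)) (interchange m n (m ^ k) (n ^ k))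
  where
  interchange : ∀ a b c d → a * b * (c * d) ≡ a * c * (b * d)
  interchange = ℕ-Solver.solve-∀

infixl 7 _/[1+_]^_
_/[1+_]^_ : ℕ → ℕ → ℕ → ℕ
h /[1+ j ]^ r = (h ℕ./ suc j ^ r) {{ℕP.m^n≢0 (suc j) r}}

/[1+0]^-identity : ∀ h r → h /[1+ 0 ]^ r ≡ h
/[1+0]^-identity h r = trans (ℕD./-congʳ {{ℕP.m^n≢0 1 r}} (ℕP.^-zeroˡ r)) (ℕD.n/1≡n h)

module _ (h j r : ℕ) where
  private instance
    [1+j]^r≢0 : ℕ.NonZero (suc j ^ r)
    [1+j]^r≢0 = ℕP.m^n≢0 (suc j) r
    [2+j]^r≢0 : ℕ.NonZero (suc (suc j) ^ r)
    [2+j]^r≢0 = ℕP.m^n≢0 (suc (suc j)) r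

  /[1+]^-≤ : h /[1+ j ]^ r ≤ h
  /[1+]^-≤ = ℕD.m/n≤m h (suc j ^ r)

  /[1+]^-pos : suc j ^ r ≤ h → 1 ≤ h /[1+ j ]^ r
  /[1+]^-pos = ℕD.m≥n⇒m/n>0

  /[1+]^-anti : h /[1+ suc j ]^ r ≤ h /[1+ j ]^ r
  /[1+]^-anti = ℕD./-monoʳ-≤ h (ℕP.^-monoˡ-≤ r (ℕP.n≤1+n (suc j)))

  *-/[1+]^-≤ : suc j ^ r * (h /[1+ j ]^ r) ≤ h
  *-/[1+]^-≤ = subst (_≤ h) (ℕP.*-comm (h /[1+ j ]^ r) (suc j ^ r)) (ℕD.m/n*n≤m h (suc j ^ r))

  /[1+]^-greatest : ∀ {v} → suc j ^ r * v ≤ h → v ≤ h /[1+ j ]^ r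
  /[1+]^-greatest {v} le = subst (_≤ h /[1+ j ]^ r) (ℕD.m*n/n≡m v (suc j ^ r))
    (ℕD./-monoˡ-≤ (suc j ^ r) (subst (_≤ h) (ℕP.*-comm (suc j ^ r) v) le))

floorRoot : ℕ → ℕ → ℕ → ℕ
floorRoot r h zero    = 0
floorRoot r h (suc n) with suc n ^ r ≤? h
... | yes _ = suc n
... | no  _ = floorRoot r h n

floorRoot-^≤ : ∀ r h n → 1 ≤ floorRoot r h n → floorRoot r h n ^ r ≤ h
floorRoot-^≤ r h (suc n) pos with suc n ^ r ≤? h
... | yes le = le
... | no  _  = floorRoot-^≤ r h n pos

floorRoot-greatest : ∀ r h n {d} → d ≤ n → d ^ r ≤ h → d ≤ floorRoot r h n
floorRoot-greatest r h zero    d≤0   _    = d≤0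
floorRoot-greatest r h (suc n) {d} d≤1+n dʳ≤h with suc n ^ r ≤? h | d ℕ.≟ suc n
... | yes _    | _        = d≤1+n
... | no  ¬le  | yes refl = ⊥-elim (¬le dʳ≤h)
... | no  _    | no  d≢   = floorRoot-greatest r h n (ℕP.≤-pred (ℕP.≤∧≢⇒< d≤1+n d≢)) dʳ≤h

-- Bernoulli's inequality and the root bound

bernoulli : ∀ k n → k ^ n * (suc k ℕ.+ n) ≤ suc k ^ suc n
bernoulli k zero    = ℕP.≤-reflexive (base k)
  where
  base : ∀ k → 1 * (suc k ℕ.+ 0) ≡ suc k * 1
  base = ℕ-Solver.solve-∀
bernoulli k (suc n) = begin
  k ^ suc n * (suc k ℕ.+ suc n)                      ≤⟨ ℕP.m≤m+n _ (k ^ n * suc n) ⟩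
  k ^ suc n * (suc k ℕ.+ suc n) ℕ.+ k ^ n * suc n    ≡⟨ expand k (k ^ n) n ⟩
  suc k * (k ^ n * (suc k ℕ.+ n))                    ≤⟨ ℕP.*-monoʳ-≤ (suc k) (bernoulli k n) ⟩
  suc k ^ suc (suc n)                                ∎
  where
  open ℕP.≤-Reasoning
  expand : ∀ k x n → k * x * (suc k ℕ.+ suc n) ℕ.+ x * suc n ≡ suc k * (x * (suc k ℕ.+ n))
  expand = ℕ-Solver.solve-∀

shrink-step-ℕ : ∀ r m k → r * m ≡ suc k → k ^ r * suc m ≤ suc k ^ r * m
shrink-step-ℕ (suc r′) m k rm≡1+k = ℕP.*-cancelˡ-≤ r (begin
  r * (k ^ r * suc m)          ≡⟨ regroup r′ m (k ^ r) ⟩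
  k ^ r * (r * m ℕ.+ r)        ≡⟨ cong (λ t → k ^ r * (t ℕ.+ r)) rm≡1+k ⟩
  k ^ r * (suc k ℕ.+ r)        ≤⟨ bernoulli k r ⟩
  suc k * suc k ^ r            ≡⟨ cong (_* suc k ^ r) rm≡1+k ⟨
  r * m * suc k ^ r            ≡⟨ swap r m (suc k ^ r) ⟩
  r * (suc k ^ r * m)          ∎)
  where
  open ℕP.≤-Reasoning
  r : ℕ
  r = suc r′
  regroup : ∀ r′ m x → suc r′ * (x * suc m) ≡ x * (suc r′ * m ℕ.+ suc r′)
  regroup = ℕ-Solver.solve-∀
  swap : ∀ a b c → a * b * c ≡ a * (c * b)
  swap = ℕ-Solver.solve-∀

-- Equivalently (h/m)^{1/r} - (h/(m+1))^{1/r} ≤ (h/m)^{1/r}/(rm): the mean value estimate for t ↦ (h/t)^{1/r}.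
shrink-step : ∀ r m → 1 ≤ r * m → (1ℚ ℚ.- invℕ (r * m)) ^ℚ r ℚ.* fromℕ (suc m) ℚ.≤ fromℕ m
shrink-step r m _ with r * m in rm≡1+k
... | suc k = begin
  (1ℚ ℚ.- i) ^ℚ r ℚ.* fromℕ (suc m)              ≡⟨ cong (λ t → t ^ℚ r ℚ.* fromℕ (suc m)) 1-i≡k*i ⟩
  (fromℕ k ℚ.* i) ^ℚ r ℚ.* fromℕ (suc m)         ≡⟨ pull-out k (suc m) ⟩
  fromℕ (k ^ r * suc m) ℚ.* i ^ℚ r               ≤⟨ ℚP.*-monoʳ-≤-nonNeg (i ^ℚ r) {{ℚ.nonNegative (^ℚ-nonNeg r (invℕ-nonNeg (suc k)))}}
                                                      (fromℕ-mono-≤ (shrink-step-ℕ r m k rm≡1+k)) ⟩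
  fromℕ (suc k ^ r * m) ℚ.* i ^ℚ r               ≡⟨ pull-out (suc k) m ⟨
  (fromℕ (suc k) ℚ.* i) ^ℚ r ℚ.* fromℕ m         ≡⟨ cong (λ t → t ^ℚ r ℚ.* fromℕ m) (fromℕ*invℕ k) ⟩
  1ℚ ^ℚ r ℚ.* fromℕ m                            ≡⟨ trans (cong (ℚ._* fromℕ m) (^ℚ-zeroˡ r)) (ℚP.*-identityˡ (fromℕ m)) ⟩
  fromℕ m                                        ∎
  where
  open ℚP.≤-Reasoning
  i : ℚ
  i = invℕ (suc k)
  1-i≡k*i : 1ℚ ℚ.- i ≡ fromℕ k ℚ.* i
  1-i≡k*i = begin-equality
    1ℚ ℚ.- i                          ≡⟨ cong (ℚ._- i) (fromℕ*invℕ k) ⟨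
    fromℕ (suc k) ℚ.* i ℚ.- i         ≡⟨ cong (λ t → t ℚ.* i ℚ.- i) (fromℕ-+ 1 k) ⟩
    (1ℚ ℚ.+ fromℕ k) ℚ.* i ℚ.- i      ≡⟨ cancel (fromℕ k) i ⟩
    fromℕ k ℚ.* i                     ∎
    where
    cancel : ∀ a b → (1ℚ ℚ.+ a) ℚ.* b ℚ.- b ≡ a ℚ.* b
    cancel = RingSolver.solve-∀ ℚ-ring
  pull-out : ∀ a b → (fromℕ a ℚ.* i) ^ℚ r ℚ.* fromℕ b ≡ fromℕ (a ^ r * b) ℚ.* i ^ℚ r
  pull-out a b = begin-equality
    (fromℕ a ℚ.* i) ^ℚ r ℚ.* fromℕ b          ≡⟨ cong (ℚ._* fromℕ b) (^ℚ-distribʳ-* (fromℕ a) i r) ⟩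
    fromℕ a ^ℚ r ℚ.* i ^ℚ r ℚ.* fromℕ b       ≡⟨ swap (fromℕ a ^ℚ r) (i ^ℚ r) (fromℕ b) ⟩
    fromℕ a ^ℚ r ℚ.* fromℕ b ℚ.* i ^ℚ r       ≡⟨ cong (λ t → t ℚ.* fromℕ b ℚ.* i ^ℚ r) (fromℕ-^ a r) ⟨
    fromℕ (a ^ r) ℚ.* fromℕ b ℚ.* i ^ℚ r      ≡⟨ cong (ℚ._* i ^ℚ r) (fromℕ-* (a ^ r) b) ⟨
    fromℕ (a ^ r * b) ℚ.* i ^ℚ r              ∎
    where
    swap : ∀ a b c → a ℚ.* b ℚ.* c ≡ a ℚ.* c ℚ.* b
    swap = RingSolver.solve-∀ ℚ-ring

module RootBound (r′ h : ℕ) (q : ℕ → ℚ)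
  (q-bound : ∀ m → 1 ≤ m → m < h → (0ℚ ℚ.≤ q m) × (fromℕ h ℚ.≤ fromℕ m ℚ.* (q m ^ℚ suc r′))) where

  r : ℕ
  r = suc r′

  w : ℕ → ℚ
  w m = q m ℚ.* invℕ (r * m)

  private
    ^-cancel-by : ∀ {y z} m → 1 ≤ m → 0ℚ ℚ.≤ z → y ^ℚ r ℚ.* fromℕ m ℚ.≤ z ^ℚ r ℚ.* fromℕ m → y ℚ.≤ z
    ^-cancel-by (suc m) _ 0≤z le = ^ℚ-cancelˡ-≤ r′ 0≤z (ℚP.*-cancelʳ-≤-pos (fromℕ (suc m)) {{ℚ.positive (fromℕ-pos m)}} le)

  -- Sum of shrink-step over m, m + 1, …, h - 1.
  root-bound : ∀ m → 1 ≤ m → m ≤ h → ∀ y → 0ℚ ℚ.≤ y → y ^ℚ r ℚ.* fromℕ m ℚ.≤ fromℕ h →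
               y ℚ.- 1ℚ ℚ.≤ sumRange m h w
  root-bound m 1≤m m≤h = go (h ℕ.∸ m) m (ℕP.m∸n+n≡m m≤h) 1≤m
    where
    open ℚP.≤-Reasoning
    go : ∀ k m → k ℕ.+ m ≡ h → 1 ≤ m → ∀ y → 0ℚ ℚ.≤ y → y ^ℚ r ℚ.* fromℕ m ℚ.≤ fromℕ h →
         y ℚ.- 1ℚ ℚ.≤ sumRange m h w
    go zero m refl 1≤m y 0≤y yʳh≤h = begin
      y ℚ.- 1ℚ        ≤⟨ ℚP.+-monoˡ-≤ (ℚ.- 1ℚ) y≤1 ⟩
      1ℚ ℚ.- 1ℚ       ≡⟨ ℚP.+-inverseʳ 1ℚ ⟩
      0ℚ              ≡⟨ ℚP.+-inverseʳ (sumℚ m w) ⟨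
      sumRange m m w  ∎
      where
      y≤1 : y ℚ.≤ 1ℚ
      y≤1 = ^-cancel-by m 1≤m (ℚP.nonNegative⁻¹ 1ℚ) (subst (y ^ℚ r ℚ.* fromℕ m ℚ.≤_)
              (sym (trans (cong (ℚ._* fromℕ m) (^ℚ-zeroˡ r)) (ℚP.*-identityˡ (fromℕ m)))) yʳh≤h)
    go (suc k) m 1+k+m≡h 1≤m y 0≤y yʳm≤h = begin
      y ℚ.- 1ℚ                                ≡⟨ split y i ⟩
      (z ℚ.- 1ℚ) ℚ.+ y ℚ.* i                  ≤⟨ ℚP.+-mono-≤ (go k (suc m) (trans (ℕP.+-suc k m) 1+k+m≡h) (s≤s z≤n) z 0≤z zʳ[m+1]≤h)
                                                   (ℚP.*-monoʳ-≤-nonNeg i {{ℚ.nonNegative (invℕ-nonNeg (r * m))}} y≤q) ⟩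
      sumRange (suc m) h w ℚ.+ q m ℚ.* i      ≡⟨ absorb (sumℚ h w) (sumℚ m w) (w m) ⟩
      sumRange m h w                          ∎
      where
      i z : ℚ
      i = invℕ (r * m)
      z = y ℚ.* (1ℚ ℚ.- i)
      split : ∀ y i → y ℚ.- 1ℚ ≡ (y ℚ.* (1ℚ ℚ.- i) ℚ.- 1ℚ) ℚ.+ y ℚ.* i
      split = RingSolver.solve-∀ ℚ-ring
      absorb : ∀ a b c → (a ℚ.- (b ℚ.+ c)) ℚ.+ c ≡ a ℚ.- b
      absorb = RingSolver.solve-∀ ℚ-ring
      m<h : m < h
      m<h = subst (m <_) 1+k+m≡h (s≤s (ℕP.m≤n+m m k))
      0≤z : 0ℚ ℚ.≤ z
      0≤z = *-nonNeg 0≤y (p≤q⇒0≤q-p (invℕ≤1 (r * m)))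
      zʳ[m+1]≤h : z ^ℚ r ℚ.* fromℕ (suc m) ℚ.≤ fromℕ h
      zʳ[m+1]≤h = begin
        z ^ℚ r ℚ.* fromℕ (suc m)                          ≡⟨ cong (ℚ._* fromℕ (suc m)) (^ℚ-distribʳ-* y (1ℚ ℚ.- i) r) ⟩
        y ^ℚ r ℚ.* (1ℚ ℚ.- i) ^ℚ r ℚ.* fromℕ (suc m)      ≡⟨ ℚP.*-assoc (y ^ℚ r) _ _ ⟩
        y ^ℚ r ℚ.* ((1ℚ ℚ.- i) ^ℚ r ℚ.* fromℕ (suc m))    ≤⟨ ℚP.*-monoˡ-≤-nonNeg (y ^ℚ r) {{ℚ.nonNegative (^ℚ-nonNeg r 0≤y)}}
                                                               (shrink-step r m (ℕP.*-mono-≤ (s≤s (z≤n {r′})) 1≤m)) ⟩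
        y ^ℚ r ℚ.* fromℕ m                                ≤⟨ yʳm≤h ⟩
        fromℕ h                                           ∎
      y≤q : y ℚ.≤ q m
      y≤q = let 0≤q , h≤mqʳ = q-bound m 1≤m m<h in
        ^-cancel-by m 1≤m 0≤q (ℚP.≤-trans yʳm≤h (subst (fromℕ h ℚ.≤_) (ℚP.*-comm (fromℕ m) _) h≤mqʳ))

  root-bound-ℕ : ∀ d m → 1 ≤ m → suc d ^ r * m ≤ h → fromℕ d ℚ.≤ sumRange m h w
  root-bound-ℕ d m 1≤m le = subst (ℚ._≤ sumRange m h w) 1+d-1≡d
    (root-bound m 1≤m m≤h (fromℕ (suc d)) (fromℕ-nonNeg (suc d)) (subst (ℚ._≤ fromℕ h) cast (fromℕ-mono-≤ le)))
    where
    m≤h : m ≤ h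
    m≤h = ℕP.≤-trans (ℕP.m≤n*m m (suc d ^ r) {{ℕP.m^n≢0 (suc d) r}}) le
    cast : fromℕ (suc d ^ r * m) ≡ fromℕ (suc d) ^ℚ r ℚ.* fromℕ m
    cast = trans (fromℕ-* (suc d ^ r) m) (cong (ℚ._* fromℕ m) (fromℕ-^ (suc d) r))
    cancel : ∀ a → (1ℚ ℚ.+ a) ℚ.- 1ℚ ≡ a
    cancel = RingSolver.solve-∀ ℚ-ring
    1+d-1≡d : fromℕ (suc d) ℚ.- 1ℚ ≡ fromℕ d
    1+d-1≡d = trans (cong (ℚ._- 1ℚ) (fromℕ-+ 1 d)) (cancel (fromℕ d))

  -- Summation by parts, with the layers [h/(j+2)^r, h/(j+1)^r) and the root bound.
  layered-sum-≤ : (f : ℕ → ℚ) → (∀ m → 0ℚ ℚ.≤ f m) → (∀ {m m′} → 1 ≤ m → m ≤ m′ → m′ ≤ h → f m ℚ.≤ f m′) →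
                  ∀ n → 1 ≤ n → n ^ r ≤ h →
                  sumℚ n (λ j → f (h /[1+ j ]^ r)) ℚ.≤ f h ℚ.+ sumFrom1 h (λ m → f m ℚ.* q m ℚ.* invℕ (r * m))
  layered-sum-≤ f 0≤f f-mono (suc n) _ [1+n]ʳ≤h = begin
    sumℚ (suc n) (f ∘ a)                                      ≡⟨ sumℚ-suc n (f ∘ a) ⟩
    f (a 0) ℚ.+ sumℚ n c                                      ≡⟨ cong (λ t → f t ℚ.+ sumℚ n c) (/[1+0]^-identity h r) ⟩
    f h ℚ.+ sumℚ n c                                          ≤⟨ ℚP.+-monoʳ-≤ (f h) (abel-summation-≤ n c V V₀≡0 j≤V 0≤c c-anti) ⟩
    f h ℚ.+ sumℚ n (λ j → c j ℚ.* (V (suc j) ℚ.- V j))        ≤⟨ ℚP.+-monoʳ-≤ (f h) (sumℚ-mono-≤ n layer) ⟩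
    f h ℚ.+ sumℚ n (λ j → U (suc j) ℚ.- U j)                  ≡⟨ cong (f h ℚ.+_) (sumℚ-telescope n U) ⟩
    f h ℚ.+ (U n ℚ.- U 0)                                     ≤⟨ ℚP.+-monoʳ-≤ (f h) Uₙ-U₀≤ ⟩
    f h ℚ.+ sumℚ h g                                          ≡⟨ cong (f h ℚ.+_) (sumℚ≡sumFrom1 h g g₀≡0) ⟩
    f h ℚ.+ sumFrom1 h g                                      ∎
    where
    open ℚP.≤-Reasoning
    a : ℕ → ℕ
    a j = h /[1+ j ]^ r
    c : ℕ → ℚ
    c j = f (a (suc j))
    g : ℕ → ℚ
    g m = f m ℚ.* q m ℚ.* invℕ (r * m)
    V U : ℕ → ℚ
    V j = sumRange (a j) h w
    U j = sumRange (a j) h g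
    1≤a : ∀ {j} → j ≤ n → 1 ≤ a j
    1≤a j≤n = /[1+]^-pos h _ r (ℕP.≤-trans (ℕP.^-monoˡ-≤ r (s≤s j≤n)) [1+n]ʳ≤h)
    a≤h : ∀ {j} → a j ≤ h
    a≤h {j} = /[1+]^-≤ h j r
    range-difference : ∀ t s s′ → (t ℚ.- s′) ℚ.- (t ℚ.- s) ≡ s ℚ.- s′
    range-difference = RingSolver.solve-∀ ℚ-ring
    V₀≡0 : V 0 ≡ 0ℚ
    V₀≡0 = trans (cong (λ t → sumRange t h w) (/[1+0]^-identity h r)) (ℚP.+-inverseʳ (sumℚ h w))
    j≤V : ∀ j → j ≤ n → fromℕ j ℚ.≤ V j
    j≤V j j≤n = root-bound-ℕ j (a j) (1≤a j≤n) (*-/[1+]^-≤ h j r)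
    0≤c : ∀ j → j < n → 0ℚ ℚ.≤ c j
    0≤c j _ = 0≤f (a (suc j))
    c-anti : ∀ j → suc j < n → c (suc j) ℚ.≤ c j
    c-anti j 2+j≤n = f-mono (1≤a 2+j≤n) (/[1+]^-anti h (suc j) r) a≤h
    g₀≡0 : g 0 ≡ 0ℚ
    g₀≡0 = trans (cong (λ t → f 0 ℚ.* q 0 ℚ.* invℕ t) (ℕP.*-zeroʳ r)) (ℚP.*-zeroʳ (f 0 ℚ.* q 0))
    0≤g : ∀ i → i < h → 0ℚ ℚ.≤ g i
    0≤g zero    _   = ℚP.≤-reflexive (sym g₀≡0)
    0≤g (suc i) i<h = *-nonNeg (*-nonNeg (0≤f (suc i)) (proj₁ (q-bound (suc i) (s≤s z≤n) i<h))) (invℕ-nonNeg (r * suc i))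
    layer : ∀ j → j < n → c j ℚ.* (V (suc j) ℚ.- V j) ℚ.≤ U (suc j) ℚ.- U j
    layer j j<n = begin
      c j ℚ.* (V (suc j) ℚ.- V j)            ≡⟨ cong (c j ℚ.*_) (range-difference (sumℚ h w) (sumℚ (a j) w) (sumℚ (a (suc j)) w)) ⟩
      c j ℚ.* sumRange (a (suc j)) (a j) w   ≤⟨ *-sumRange-≤ (c j) w g (/[1+]^-anti h j r) weight ⟩
      sumRange (a (suc j)) (a j) g           ≡⟨ range-difference (sumℚ h g) (sumℚ (a j) g) (sumℚ (a (suc j)) g) ⟨
      U (suc j) ℚ.- U j                      ∎
      where
      weight : ∀ i → a (suc j) ≤ i → i < a j → c j ℚ.* w i ℚ.≤ g i
      weight i a′≤i i<a = subst (c j ℚ.* w i ℚ.≤_) (sym (ℚP.*-assoc (f i) (q i) (invℕ (r * i))))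
        (ℚP.*-monoʳ-≤-nonNeg (w i) {{ℚ.nonNegative 0≤w}} (f-mono (1≤a j<n) a′≤i (ℕP.<⇒≤ i<h)))
        where
        1≤i : 1 ≤ i
        1≤i = ℕP.≤-trans (1≤a j<n) a′≤i
        i<h : i < h
        i<h = ℕP.<-≤-trans i<a a≤h
        0≤w : 0ℚ ℚ.≤ w i
        0≤w = *-nonNeg (proj₁ (q-bound i 1≤i i<h)) (invℕ-nonNeg (r * i))
    Uₙ-U₀≤ : U n ℚ.- U 0 ℚ.≤ sumℚ h g
    Uₙ-U₀≤ = begin
      U n ℚ.- U 0                     ≡⟨ cong (λ t → U n ℚ.- sumRange t h g) (/[1+0]^-identity h r) ⟩
      U n ℚ.- sumRange h h g          ≡⟨ cong (λ t → U n ℚ.- t) (ℚP.+-inverseʳ (sumℚ h g)) ⟩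
      U n ℚ.- 0ℚ                      ≡⟨ ℚP.+-identityʳ (U n) ⟩
      sumℚ h g ℚ.- sumℚ (a n) g       ≤⟨ ℚP.+-monoʳ-≤ (sumℚ h g) (ℚP.neg-antimono-≤ (sumℚ-nonNeg (a n) g λ i i<a → 0≤g i (ℕP.<-≤-trans i<a a≤h))) ⟩
      sumℚ h g ℚ.- 0ℚ                 ≡⟨ ℚP.+-identityʳ (sumℚ h g) ⟩
      sumℚ h g                        ∎

-- Binary forms and primitive points

^ℤ-distribʳ-* : ∀ i j n → (i ℤ.* j) ℤ.^ n ≡ i ℤ.^ n ℤ.* j ℤ.^ n
^ℤ-distribʳ-* i j zero    = refl
^ℤ-distribʳ-* i j (suc n) = trans (cong (i ℤ.* j ℤ.*_) (^ℤ-distribʳ-* i j n)) (interchange i j (i ℤ.^ n) (j ℤ.^ n))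
  where
  interchange : ∀ a b c d → a ℤ.* b ℤ.* (c ℤ.* d) ≡ a ℤ.* c ℤ.* (b ℤ.* d)
  interchange = ℤ-Solver.solve-∀

pos-^ : ∀ m n → + (m ^ n) ≡ (+ m) ℤ.^ n
pos-^ m zero    = refl
pos-^ m (suc n) = trans (ℤP.pos-* m (m ^ n)) (cong (+ m ℤ.*_) (pos-^ m n))

sumℤ-cong : ∀ n {f g : ℕ → ℤ} → (∀ i → i < n → f i ≡ g i) → sumℤ n f ≡ sumℤ n g
sumℤ-cong zero    _   = refl
sumℤ-cong (suc n) f≗g = cong₂ ℤ._+_ (sumℤ-cong n λ i i<n → f≗g i (ℕP.m≤n⇒m≤1+n i<n)) (f≗g n ℕP.≤-refl)

sumℤ-distribˡ : ∀ n k (f : ℕ → ℤ) → sumℤ n (λ i → k ℤ.* f i) ≡ k ℤ.* sumℤ n f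
sumℤ-distribˡ zero    k f = sym (ℤP.*-zeroʳ k)
sumℤ-distribˡ (suc n) k f =
  trans (cong (ℤ._+ k ℤ.* f n) (sumℤ-distribˡ n k f)) (sym (ℤP.*-distribˡ-+ k (sumℤ n f) (f n)))

eval-homogeneous : ∀ {r} (F : Form r) d x y → eval F (d ℤ.* x) (d ℤ.* y) ≡ d ℤ.^ r ℤ.* eval F x y
eval-homogeneous {r} F d x y = trans (sumℤ-cong (suc r) term) (sumℤ-distribˡ (suc r) (d ℤ.^ r) _)
  where
  open ≡-Reasoning
  regroup : ∀ c a u b v → c ℤ.* (a ℤ.* u) ℤ.* (b ℤ.* v) ≡ a ℤ.* b ℤ.* (c ℤ.* u ℤ.* v)
  regroup = ℤ-Solver.solve-∀
  term : ∀ i → i < suc r → coef F i ℤ.* (d ℤ.* x) ℤ.^ (r ℕ.∸ i) ℤ.* (d ℤ.* y) ℤ.^ i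
                           ≡ d ℤ.^ r ℤ.* (coef F i ℤ.* x ℤ.^ (r ℕ.∸ i) ℤ.* y ℤ.^ i)
  term i (s≤s i≤r) = begin
    coef F i ℤ.* (d ℤ.* x) ℤ.^ (r ℕ.∸ i) ℤ.* (d ℤ.* y) ℤ.^ i
      ≡⟨ cong₂ (λ u v → coef F i ℤ.* u ℤ.* v) (^ℤ-distribʳ-* d x (r ℕ.∸ i)) (^ℤ-distribʳ-* d y i) ⟩
    coef F i ℤ.* (d ℤ.^ (r ℕ.∸ i) ℤ.* x ℤ.^ (r ℕ.∸ i)) ℤ.* (d ℤ.^ i ℤ.* y ℤ.^ i)
      ≡⟨ regroup (coef F i) (d ℤ.^ (r ℕ.∸ i)) (x ℤ.^ (r ℕ.∸ i)) (d ℤ.^ i) (y ℤ.^ i) ⟩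
    d ℤ.^ (r ℕ.∸ i) ℤ.* d ℤ.^ i ℤ.* (coef F i ℤ.* x ℤ.^ (r ℕ.∸ i) ℤ.* y ℤ.^ i)
      ≡⟨ cong (ℤ._* _) (trans (sym (ℤP.^-distribˡ-+-* d (r ℕ.∸ i) i)) (cong (d ℤ.^_) (ℕP.m∸n+n≡m i≤r))) ⟩
    d ℤ.^ r ℤ.* (coef F i ℤ.* x ℤ.^ (r ℕ.∸ i) ℤ.* y ℤ.^ i)
      ∎

scale : ℕ → ℤ × ℤ → ℤ × ℤ
scale d (x , y) = + d ℤ.* x , + d ℤ.* y

∣eval-scale∣ : ∀ {r} (F : Form r) d x y → ℤ.∣ eval F (+ d ℤ.* x) (+ d ℤ.* y) ∣ ≡ d ^ r * ℤ.∣ eval F x y ∣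
∣eval-scale∣ {r} F d x y = begin
  ℤ.∣ eval F (+ d ℤ.* x) (+ d ℤ.* y) ∣     ≡⟨ cong ℤ.∣_∣ (eval-homogeneous F (+ d) x y) ⟩
  ℤ.∣ (+ d) ℤ.^ r ℤ.* eval F x y ∣         ≡⟨ ℤP.abs-* ((+ d) ℤ.^ r) (eval F x y) ⟩
  ℤ.∣ (+ d) ℤ.^ r ∣ * ℤ.∣ eval F x y ∣     ≡⟨ cong (λ t → ℤ.∣ t ∣ * ℤ.∣ eval F x y ∣) (pos-^ d r) ⟨
  d ^ r * ℤ.∣ eval F x y ∣                 ∎
  where open ≡-Reasoning

scale-nonZero : ∀ k {x y} → ¬ (x ≡ + 0 × y ≡ + 0) → ¬ (+ suc k ℤ.* x ≡ + 0 × + suc k ℤ.* y ≡ + 0)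
scale-nonZero k nz (kx≡0 , ky≡0) = nz (cancel kx≡0 , cancel ky≡0)
  where
  cancel : ∀ {z} → + suc k ℤ.* z ≡ + 0 → z ≡ + 0
  cancel kz≡0 with ℤP.i*j≡0⇒i≡0∨j≡0 (+ suc k) kz≡0
  ... | inj₂ z≡0 = z≡0

suc-*-cancelʳ : ∀ {k j} z → z ≢ + 0 → + suc k ℤ.* z ≡ + suc j ℤ.* z → k ≡ j
suc-*-cancelʳ {k} {j} z z≢0 eq =
  ℕP.suc-injective (ℤP.+-injective (ℤP.*-cancelʳ-≡ (+ suc k) (+ suc j) z {{ℤ.≢-nonZero z≢0}} eq))

scale-injective : ∀ {k j x y} → ¬ (x ≡ + 0 × y ≡ + 0) → scale (suc k) (x , y) ≡ scale (suc j) (x , y) → k ≡ j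
scale-injective {x = x} {y} nz eq with x ℤ.≟ + 0
... | no  x≢0 = suc-*-cancelʳ x x≢0 (cong proj₁ eq)
... | yes x≡0 = suc-*-cancelʳ y (λ y≡0 → nz (x≡0 , y≡0)) (cong proj₂ eq)

Primitive : ℤ × ℤ → Set
Primitive (x , y) = gcd ℤ.∣ x ∣ ℤ.∣ y ∣ ≡ 1

primitive-nonZero : ∀ {x y} → Primitive (x , y) → ¬ (x ≡ + 0 × y ≡ + 0)
primitive-nonZero coprime (refl , refl) with trans (sym gcd[0,0]≡0) coprime
... | ()

∣-abs⇒factor : ∀ {g} z → g ∣ ℤ.∣ z ∣ → ∃ λ z′ → z ≡ + g ℤ.* z′
∣-abs⇒factor {g} z g∣z with Signed.∣ᵤ⇒∣ {+ g} {z} g∣z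
... | Signed.divides z′ z≡z′g = z′ , trans z≡z′g (ℤP.*-comm z′ (+ g))

primitive-decomposition : ∀ x y → ¬ (x ≡ + 0 × y ≡ + 0) →
                          ∃₂ λ k p → (x , y) ≡ scale (suc k) p × Primitive p
primitive-decomposition x y nz with gcd ℤ.∣ x ∣ ℤ.∣ y ∣ in gcd≡
... | zero  = ⊥-elim (nz (ℤP.∣i∣≡0⇒i≡0 (gcd[m,n]≡0⇒m≡0 gcd≡) , ℤP.∣i∣≡0⇒i≡0 (gcd[m,n]≡0⇒n≡0 ℤ.∣ x ∣ gcd≡)))
... | suc k with ∣-abs⇒factor x (subst (_∣ ℤ.∣ x ∣) gcd≡ (gcd[m,n]∣m ℤ.∣ x ∣ ℤ.∣ y ∣))
               | ∣-abs⇒factor y (subst (_∣ ℤ.∣ y ∣) gcd≡ (gcd[m,n]∣n ℤ.∣ x ∣ ℤ.∣ y ∣))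
...   | x′ , refl | y′ , refl = k , (x′ , y′) , refl , coprime
  where
  g : ℕ
  g = suc k
  coprime : gcd ℤ.∣ x′ ∣ ℤ.∣ y′ ∣ ≡ 1
  coprime = ℕP.*-cancelˡ-≡ (gcd ℤ.∣ x′ ∣ ℤ.∣ y′ ∣) 1 g (begin
    g * gcd ℤ.∣ x′ ∣ ℤ.∣ y′ ∣                  ≡⟨ c*gcd[m,n]≡gcd[cm,cn] g ℤ.∣ x′ ∣ ℤ.∣ y′ ∣ ⟩
    gcd (g * ℤ.∣ x′ ∣) (g * ℤ.∣ y′ ∣)          ≡⟨ cong₂ gcd (ℤP.abs-* (+ g) x′) (ℤP.abs-* (+ g) y′) ⟨
    gcd ℤ.∣ + g ℤ.* x′ ∣ ℤ.∣ + g ℤ.* y′ ∣      ≡⟨ gcd≡ ⟩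
    g                                          ≡⟨ ℕP.*-identityʳ g ⟨
    g * 1                                      ∎)
    where open ≡-Reasoning

Unique-⊆⇒length-≤ : ∀ {A : Set} {xs ys : List A} → Unique xs → xs ⊆ ys → length xs ≤ length ys
Unique-⊆⇒length-≤ {xs = []}     _               _     = z≤n
Unique-⊆⇒length-≤ {xs = x ∷ xs} (x∉xs ∷ unique) xs⊆ys with ∈-∃++ (xs⊆ys (here refl))
... | ys₁ , ys₂ , refl = begin
  suc (length xs)            ≤⟨ s≤s (Unique-⊆⇒length-≤ unique xs⊆ys₁++ys₂) ⟩
  suc (length (ys₁ ++ ys₂))  ≡⟨ LP.length-++-sucʳ ys₁ x ys₂ ⟨
  length (ys₁ ++ x ∷ ys₂)    ∎
  where
  open ℕP.≤-Reasoning
  xs⊆ys₁++ys₂ : xs ⊆ ys₁ ++ ys₂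
  xs⊆ys₁++ys₂ z∈xs with ∈-++⁻ ys₁ (xs⊆ys (there z∈xs))
  ... | inj₁ z∈ys₁         = ∈-++⁺ˡ z∈ys₁
  ... | inj₂ (here refl)   = ⊥-elim (All.lookup x∉xs z∈xs refl)
  ... | inj₂ (there z∈ys₂) = ∈-++⁺ʳ ys₁ z∈ys₂

-- All multiples of a nontrivial zero of F would be solutions.
count⇒nonvanishing : ∀ {r} (F : Form r) {h N} → IsCount (Sol F h) N →
                     ∀ {x y} → ¬ (x ≡ + 0 × y ≡ + 0) → eval F x y ≢ + 0
count⇒nonvanishing {r} F {h} {N} (xs , _ , sol⇔∈xs , |xs|≡N) {x} {y} nz F[x,y]≡0 = ℕP.<-irrefl refl (begin-strict
  N                 <⟨ ℕP.n<1+n N ⟩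
  suc N             ≡⟨ trans (LP.length-map _ (upTo (suc N))) (LP.length-upTo (suc N)) ⟨
  length multiples  ≤⟨ Unique-⊆⇒length-≤ (UniqueP.map⁺ (scale-injective nz) (UniqueP.upTo⁺ (suc N))) multiples⊆xs ⟩
  length xs         ≡⟨ |xs|≡N ⟩
  N                 ∎)
  where
  open ℕP.≤-Reasoning
  multiples : List (ℤ × ℤ)
  multiples = map (λ k → scale (suc k) (x , y)) (upTo (suc N))
  multiples⊆xs : multiples ⊆ xs
  multiples⊆xs p∈multiples with ∈-map⁻ (λ k → scale (suc k) (x , y)) {xs = upTo (suc N)} p∈multiples
  ... | k , _ , refl = Equivalence.to (sol⇔∈xs _) (scale-nonZero k nz , ℕP.≤-trans (ℕP.≤-reflexive F[kx,ky]≡0) z≤n)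
    where
    F[kx,ky]≡0 : ℤ.∣ eval F (+ suc k ℤ.* x) (+ suc k ℤ.* y) ∣ ≡ 0
    F[kx,ky]≡0 = trans (∣eval-scale∣ F (suc k) x y) (trans (cong (λ t → suc k ^ r * ℤ.∣ t ∣) F[x,y]≡0) (ℕP.*-zeroʳ (suc k ^ r)))


-- Counting solutions by their primitive parts

module Counting (r′ : ℕ) (F : Form (suc r′)) (h : ℕ) (P : ℕ → ℕ)
  (P-count : ∀ m → 1 ≤ m → m ≤ h → IsCount (PrimSol F m) (P m)) where

  r : ℕ
  r = suc r′

  primitives : ℕ → List (ℤ × ℤ)
  primitives m with 1 ≤? m | m ≤? h
  ... | yes 1≤m | yes m≤h = proj₁ (P-count m 1≤m m≤h)
  ... | _       | _       = []

  Enumerates : ℕ → Set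
  Enumerates m = Unique (primitives m) × (∀ p → PrimSol F m p ⇔ p ∈ primitives m) × length (primitives m) ≡ P m

  primitives-count : ∀ m → 1 ≤ m → m ≤ h → Enumerates m
  primitives-count m 1≤m m≤h with 1 ≤? m | m ≤? h
  ... | yes 1≤m′ | yes m≤h′ = proj₂ (P-count m 1≤m′ m≤h′)
  ... | no  1≰m  | _        = contradiction 1≤m 1≰m
  ... | yes _    | no  m≰h  = contradiction m≤h m≰h

  P-mono : ∀ {m m′} → 1 ≤ m → m ≤ m′ → m′ ≤ h → P m ≤ P m′
  P-mono {m} {m′} 1≤m m≤m′ m′≤h =
    subst₂ _≤_ (proj₂ (proj₂ count)) (proj₂ (proj₂ count′)) (Unique-⊆⇒length-≤ (proj₁ count) ⊆primitives′)
    where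
    count : Enumerates m
    count = primitives-count m 1≤m (ℕP.≤-trans m≤m′ m′≤h)
    count′ : Enumerates m′
    count′ = primitives-count m′ (ℕP.≤-trans 1≤m m≤m′) m′≤h
    ⊆primitives′ : primitives m ⊆ primitives m′
    ⊆primitives′ {x , y} p∈ with Equivalence.from (proj₁ (proj₂ count) (x , y)) p∈
    ... | (nz , F≤m) , coprime = Equivalence.to (proj₁ (proj₂ count′) (x , y)) ((nz , ℕP.≤-trans F≤m m≤m′) , coprime)

  candidates : ℕ → List (ℤ × ℤ)
  candidates zero    = []
  candidates (suc j) = candidates j ++ map (scale (suc j)) (primitives (h /[1+ j ]^ r))

  ∈-candidates : ∀ {j n p} → j < n → p ∈ primitives (h /[1+ j ]^ r) → scale (suc j) p ∈ candidates n
  ∈-candidates {j} {suc n} j<1+n p∈ with j ℕ.≟ n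
  ... | yes refl = ∈-++⁺ʳ (candidates n) (∈-map⁺ (scale (suc n)) p∈)
  ... | no  j≢n  = ∈-++⁺ˡ (∈-candidates (ℕP.≤∧≢⇒< (ℕP.≤-pred j<1+n) j≢n) p∈)

  length-candidates-suc : ∀ j → suc j ^ r ≤ h →
                          length (candidates (suc j)) ≡ length (candidates j) ℕ.+ P (h /[1+ j ]^ r)
  length-candidates-suc j le = trans (LP.length-++ (candidates j)) (cong (length (candidates j) ℕ.+_)
    (trans (LP.length-map (scale (suc j)) (primitives (h /[1+ j ]^ r)))
           (proj₂ (proj₂ (primitives-count (h /[1+ j ]^ r) (/[1+]^-pos h j r le) (/[1+]^-≤ h j r))))))

  length-candidates-≤ : ∀ n → n ^ r ≤ h → length (candidates n) ≤ n * P h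
  length-candidates-≤ zero    _    = z≤n
  length-candidates-≤ (suc n) le = begin
    length (candidates (suc n))                   ≡⟨ length-candidates-suc n le ⟩
    length (candidates n) ℕ.+ P (h /[1+ n ]^ r)   ≤⟨ ℕP.+-mono-≤ (length-candidates-≤ n (ℕP.≤-trans (ℕP.^-monoˡ-≤ r (ℕP.n≤1+n n)) le))
                                                                  (P-mono (/[1+]^-pos h n r le) (/[1+]^-≤ h n r) ℕP.≤-refl) ⟩
    n * P h ℕ.+ P h                               ≡⟨ ℕP.+-comm (n * P h) (P h) ⟩
    suc n * P h                                   ∎
    where open ℕP.≤-Reasoning

  fromℕ-length-candidates : ∀ n → n ^ r ≤ h → fromℕ (length (candidates n)) ≡ sumℚ n (λ j → fromℕ (P (h /[1+ j ]^ r)))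
  fromℕ-length-candidates zero    _  = refl
  fromℕ-length-candidates (suc n) le = begin
    fromℕ (length (candidates (suc n)))                    ≡⟨ cong fromℕ (length-candidates-suc n le) ⟩
    fromℕ (length (candidates n) ℕ.+ P (h /[1+ n ]^ r))    ≡⟨ fromℕ-+ (length (candidates n)) (P (h /[1+ n ]^ r)) ⟩
    fromℕ (length (candidates n)) ℚ.+ fromℕ (P (h /[1+ n ]^ r))
      ≡⟨ cong (ℚ._+ fromℕ (P (h /[1+ n ]^ r))) (fromℕ-length-candidates n (ℕP.≤-trans (ℕP.^-monoˡ-≤ r (ℕP.n≤1+n n)) le)) ⟩
    sumℚ (suc n) (λ j → fromℕ (P (h /[1+ j ]^ r)))         ∎
    where open ≡-Reasoning

  D : ℕ
  D = floorRoot r h h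

  1≤D : 1 ≤ h → 1 ≤ D
  1≤D 1≤h = floorRoot-greatest r h h 1≤h (ℕP.≤-trans (ℕP.≤-reflexive (ℕP.^-zeroˡ r)) 1≤h)

  Dʳ≤h : 1 ≤ h → D ^ r ≤ h
  Dʳ≤h 1≤h = floorRoot-^≤ r h h (1≤D 1≤h)

  solutions⊆candidates : ∀ {N} → IsCount (Sol F h) N → ∀ {p} → Sol F h p → p ∈ candidates D
  solutions⊆candidates count {x , y} (nz , F≤h) with primitive-decomposition x y nz
  ... | k , (x′ , y′) , refl , coprime = ∈-candidates k<D (Equivalence.to (proj₁ (proj₂ prims) (x′ , y′))
                                                          ((primitive-nonZero coprime , v≤bound) , coprime))
    where
    v = ℤ.∣ eval F x′ y′ ∣
    gʳv≤h : suc k ^ r * v ≤ h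
    gʳv≤h = subst (_≤ h) (∣eval-scale∣ F (suc k) x′ y′) F≤h
    v≢0 : v ≢ 0
    v≢0 v≡0 = count⇒nonvanishing F count (primitive-nonZero coprime) (ℤP.∣i∣≡0⇒i≡0 v≡0)
    gʳ≤h : suc k ^ r ≤ h
    gʳ≤h = ℕP.≤-trans (ℕP.m≤m*n (suc k ^ r) v {{ℕ.≢-nonZero v≢0}}) gʳv≤h
    v≤bound : v ≤ h /[1+ k ]^ r
    v≤bound = /[1+]^-greatest h k r gʳv≤h
    prims : Enumerates (h /[1+ k ]^ r)
    prims = primitives-count (h /[1+ k ]^ r) (/[1+]^-pos h k r gʳ≤h) (/[1+]^-≤ h k r)
    k<D : k < D
    k<D = floorRoot-greatest r h h (ℕP.≤-trans (ℕP.m≤m*n (suc k) (suc k ^ r′) {{ℕP.m^n≢0 (suc k) r′}}) gʳ≤h) gʳ≤h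

  count≤candidates : ∀ {N} → IsCount (Sol F h) N → N ≤ length (candidates D)
  count≤candidates count@(xs , unique , sol⇔∈xs , |xs|≡N) = subst (_≤ length (candidates D)) |xs|≡N
    (Unique-⊆⇒length-≤ unique λ {p} p∈xs → solutions⊆candidates count (Equivalence.from (sol⇔∈xs p) p∈xs))

lemma2p1 : (r : ℕ) → 3 ≤ r → (F : Form r) → Irreducible F →
    (h : ℕ) → 1 ≤ h →
    (N : ℕ) → IsCount (Sol F h) N →
    (P : ℕ → ℕ) → (∀ m → 1 ≤ m → m ≤ h → IsCount (PrimSol F m) (P m)) →
    -- (i)  N ≤ P(h) h^{1/r}, i.e. N^r ≤ P(h)^r h
    (N ^ r ≤ (P h ^ r) * h)
    ×
    -- (ii) for every choice of rationals q_m ≥ (h/m)^{1/r} (1 ≤ m ≤ h-1):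
    --      N ≤ P(h) + Σ_{m=1}^{h-1} P(m) q_m / (r m)
    ((q : ℕ → ℚ) → (∀ m → 1 ≤ m → m < h → (0ℚ ℚ.≤ q m) × ((+ h ℚ./ 1) ℚ.≤ (+ m ℚ./ 1) ℚ.* (q m ^ℚ r))) →
      (+ N ℚ./ 1) ℚ.≤ (+ P h ℚ./ 1) ℚ.+ sumFrom1 h (λ m → (+ P m ℚ./ 1) ℚ.* q m ℚ.* invℕ (r * m)))
lemma2p1 (suc r′) _ F _ h 1≤h N count P P-count = part-i , part-ii
  where
  open Counting r′ F h P P-count
  N≤|candidates| : N ≤ length (candidates D)
  N≤|candidates| = count≤candidates count
  part-i : N ^ r ≤ P h ^ r * h
  part-i = begin
    N ^ r              ≤⟨ ℕP.^-monoˡ-≤ r (ℕP.≤-trans N≤|candidates| (length-candidates-≤ D (Dʳ≤h 1≤h))) ⟩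
    (D * P h) ^ r      ≡⟨ ^-distribʳ-* D (P h) r ⟩
    D ^ r * P h ^ r    ≤⟨ ℕP.*-monoˡ-≤ (P h ^ r) (Dʳ≤h 1≤h) ⟩
    h * P h ^ r        ≡⟨ ℕP.*-comm h (P h ^ r) ⟩
    P h ^ r * h        ∎
    where open ℕP.≤-Reasoning
  part-ii : (q : ℕ → ℚ) → (∀ m → 1 ≤ m → m < h → (0ℚ ℚ.≤ q m) × (fromℕ h ℚ.≤ fromℕ m ℚ.* (q m ^ℚ r))) →
            fromℕ N ℚ.≤ fromℕ (P h) ℚ.+ sumFrom1 h (λ m → fromℕ (P m) ℚ.* q m ℚ.* invℕ (r * m))
  part-ii q q-bound = begin
    fromℕ N                                        ≤⟨ fromℕ-mono-≤ N≤|candidates| ⟩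
    fromℕ (length (candidates D))                  ≡⟨ fromℕ-length-candidates D (Dʳ≤h 1≤h) ⟩
    sumℚ D (λ j → fromℕ (P (h /[1+ j ]^ r)))       ≤⟨ layered-sum-≤ (fromℕ ∘ P) (fromℕ-nonNeg ∘ P)
                                                        (λ 1≤m m≤m′ m′≤h → fromℕ-mono-≤ (P-mono 1≤m m≤m′ m′≤h))
                                                        D (1≤D 1≤h) (Dʳ≤h 1≤h) ⟩
    fromℕ (P h) ℚ.+ sumFrom1 h (λ m → fromℕ (P m) ℚ.* q m ℚ.* invℕ (r * m)) ∎
    where
    open ℚP.≤-Reasoning
    open RootBound r′ h q q-bound using (layered-sum-≤)
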